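{- Let $a,b,c$ be nonzero integers. Then the equation $ax+by+cz=0$ is not graph-regular.
   Context: Write $[N]=\{1,\dots,N\}$. An equation $\sum_{i=1}^k a_ix_i=0$ with integer coefficients and $k\ge3$ is called graph-regular if there is a function $N(r)$ such that for every $r\in\mathbb{N}$ and every $N>N(r)$, every $r$-coloring of the edges of the complete graph on vertex set $[N]$ admits pairwise distinct $x_1,\dots,x_k\in[N]$ with $\sum a_ix_i=0$ such that all edges $\{x_i,x_j\}$ ($i\ne j$) have the same color. -}

module Defs where

open import Data.Nat as ℕ using (ℕ; _≤_; _<_)
open import Data.Integer using (ℤ; +_; _*_; _+_)
open import Data.Fin using (Fin)
open import Data.Fin as Fin using ()
open import Data.Product using (Σ; ∃; _×_; _,_)
open import Relation.Binary.PropositionalEquality using (_≡_; _≢_)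
open import Function.Definitions using (Injective)

sumFin : (k : ℕ) → (Fin k → ℤ) → ℤ
sumFin ℕ.zero f = + 0
sumFin (ℕ.suc k) f = f Fin.zero + sumFin k (λ i → f (Fin.suc i))

-- An r-colouring of the edges of the complete graph on [N] = {1..N}:
-- a colour for each pair of vertices, symmetric (so it is a function on
-- unordered pairs {u,v}); values on non-edges (u = v) or outside [N] are
-- irrelevant.
EdgeColouring : ℕ → ℕ → Set
EdgeColouring r N =
  Σ (ℕ → ℕ → Fin r) λ col →
    ∀ u v → 1 ≤ u → u ≤ N → 1 ≤ v → v ≤ N → col u v ≡ col v u

MonoSolution : (k : ℕ) → (Fin k → ℤ) → (r N : ℕ) → EdgeColouring r N → Set
MonoSolution k a r N (col , _) =
  Σ (Fin k → ℕ) λ x →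
    Injective _≡_ _≡_ x
    × (∀ i → 1 ≤ x i × x i ≤ N)
    × sumFin k (λ i → a i * + (x i)) ≡ + 0
    × Σ (Fin r) λ c → ∀ i j → i ≢ j → col (x i) (x j) ≡ c

GraphRegular : (k : ℕ) → (Fin k → ℤ) → Set
GraphRegular k a =
  Σ (ℕ → ℕ) λ N₀ →
    ∀ (r N : ℕ) → N₀ r < N → (χ : EdgeColouring r N) → MonoSolution k a r N χ

-- Put K = |a| + |b| + |c| and m = K + 1, and write ord n = ⌊log₂ n⌋.  An edge
-- {u, v} with u < v receives the colour
--     ( ord v mod m ,  ord (v − u) mod m ,  [ord u = ord v] ,  [ord (v − u) + m ≤ ord v] ),
-- a palette whose size depends on K only.  Let p < q < s be a monochromatic
-- solution, with gaps d₁ = q − p, d₂ = s − q, d₃ = s − p.  Two numbers whose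
-- orders agree mod m either have equal orders, or one exceeds K times the other.
-- Since s ≤ K·q, the orders of q and s (hence of p) coincide, so d₃ < 2^(ord p).
-- If d₃ is "near" (no m-gap below ord s), all gaps have the same order, which is
-- impossible as ord (d₁ + d₂) = ord d₁ + 1.  If d₃ is "far", K·d₃ < p, so writing
-- the equation as (a+b+c)·p + b·d₁ + c·d₃ = 0 forces a + b + c = 0, whence
-- |a|·d₁ = |c|·d₂ and again ord d₁ = ord d₂.
module Submission where

open import Defs
open import Data.Integer using (ℤ; +_)
open import Data.Vec.Functional using (_∷_; [])
open import Relation.Binary.PropositionalEquality using (_≢_)
open import Relation.Nullary using (¬_)

open import Data.Nat
  using (ℕ; zero; suc; _+_; _*_; _∸_; _^_; _≤_; _<_; _⊓_; _⊔_; _%_; _/_;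
         _≟_; _≤?_; _<?_; NonZero; >-nonZero; z≤n; s≤s; s≤s⁻¹)
open import Data.Nat.Properties
open import Data.Nat.DivMod using (_mod_; m≡m%n+[m/n]*n; /-monoˡ-≤; m%n<n)
open import Data.Integer using (∣_∣)
import Data.Integer as Int
import Data.Integer.Properties as IntP
import Data.Integer.Tactic.RingSolver as IntSolver
open import Data.Fin using (Fin; toℕ; combine)
open import Data.Fin.Patterns using (0F; 1F; 2F)
open import Data.Fin.Properties using (toℕ-fromℕ<; combine-injective)
open import Data.Product using (∃-syntax; _×_; _,_; proj₁; proj₂)
open import Data.Sum using (_⊎_; inj₁; inj₂)
open import Data.Empty using (⊥; ⊥-elim)
open import Function using (_∘_)
open import Function.Bundles using (_⇔_; mk⇔; Equivalence)
open import Relation.Nullary using (Dec; yes; no)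
open import Relation.Binary.Definitions using (tri<; tri≈; tri>)
open import Relation.Binary.PropositionalEquality
  using (_≡_; refl; sym; trans; cong; cong₂; subst; module ≡-Reasoning)
import Algebra.Properties.CommutativeSemigroup as CommSemigroupProperties

dyadicInterval : ∀ n → ∃[ k ] 2 ^ k ≤ suc n × suc n < 2 ^ suc k
dyadicInterval zero = 0 , ≤-refl , s≤s (s≤s z≤n)
dyadicInterval (suc n) with dyadicInterval n
... | k , lower , upper with suc (suc n) <? 2 ^ suc k
...   | yes below = k , m≤n⇒m≤1+n lower , below
...   | no notBelow = suc k , ≮⇒≥ notBelow ,
                      ≤-<-trans upper (^-monoʳ-< 2 (s≤s (s≤s z≤n)) (n<1+n (suc k)))

-- The binary order: ord n = ⌊log₂ n⌋ for n ≥ 1 (and ord 0 = 0).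
ord : ℕ → ℕ
ord zero = 0
ord (suc n) = proj₁ (dyadicInterval n)

ord-lower : ∀ {n} → 1 ≤ n → 2 ^ ord n ≤ n
ord-lower {suc n} _ = proj₁ (proj₂ (dyadicInterval n))

ord-upper : ∀ n → n < 2 ^ suc (ord n)
ord-upper zero = s≤s z≤n
ord-upper (suc n) = proj₂ (proj₂ (dyadicInterval n))

exponent-< : ∀ {a b n} → 2 ^ a ≤ n → n < 2 ^ b → a < b
exponent-< lower upper = ≰⇒> λ b≤a → <⇒≱ upper (≤-trans (^-monoʳ-≤ 2 b≤a) lower)

ord-mono : ∀ {u v} → 1 ≤ u → u ≤ v → ord u ≤ ord v
ord-mono 1≤u u≤v = s≤s⁻¹ (exponent-< (≤-trans (ord-lower 1≤u) u≤v) (ord-upper _))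

ord-below : ∀ {n k} → 1 ≤ n → n < 2 ^ k → ord n < k
ord-below 1≤n = exponent-< (ord-lower 1≤n)

ord-unique : ∀ {n k} → 2 ^ k ≤ n → n < 2 ^ suc k → ord n ≡ k
ord-unique {n} {k} lower upper = ≤-antisym
  (s≤s⁻¹ (exponent-< (ord-lower (≤-trans (m^n>0 2 k) lower)) upper))
  (s≤s⁻¹ (exponent-< lower (ord-upper n)))

2^suc : ∀ k → 2 ^ suc k ≡ 2 ^ k + 2 ^ k
2^suc k = cong (_+_ (2 ^ k)) (+-identityʳ (2 ^ k))

ord-sum : ∀ {u v} → ord u ≡ ord v → 1 ≤ u → 1 ≤ v → ord (u + v) ≡ suc (ord u)
ord-sum {u} {v} same 1≤u 1≤v = ord-unique lower upper
  where
  open ≤-Reasoning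
  t : ℕ
  t = ord u
  lower : 2 ^ suc t ≤ u + v
  lower = begin
    2 ^ suc t     ≡⟨ 2^suc t ⟩
    2 ^ t + 2 ^ t ≤⟨ +-mono-≤ (ord-lower 1≤u) (subst (λ k → 2 ^ k ≤ v) (sym same) (ord-lower 1≤v)) ⟩
    u + v         ∎
  upper : u + v < 2 ^ suc (suc t)
  upper = begin-strict
    u + v                 <⟨ +-mono-< (ord-upper u) (subst (λ k → v < 2 ^ suc k) (sym same) (ord-upper v)) ⟩
    2 ^ suc t + 2 ^ suc t ≡⟨ sym (2^suc (suc t)) ⟩
    2 ^ suc (suc t)       ∎

n<2^n : ∀ n → n < 2 ^ n
n<2^n zero = s≤s z≤n
n<2^n (suc n) = ≤-<-trans (n<2^n n) (^-monoʳ-< 2 (s≤s (s≤s z≤n)) (n<1+n n))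

ord-dominates : ∀ K {u v} → ord u + suc K ≤ ord v → 1 ≤ v → K * u < v
ord-dominates K {u} {v} far 1≤v = begin-strict
  K * u                      <⟨ *-mono-< (n<2^n K) (ord-upper u) ⟩
  2 ^ K * 2 ^ suc (ord u)    ≡⟨ sym (^-distribˡ-+-* 2 K (suc (ord u))) ⟩
  2 ^ (K + suc (ord u))      ≤⟨ ^-monoʳ-≤ 2 (≤-trans (≤-reflexive exponents) far) ⟩
  2 ^ ord v                  ≤⟨ ord-lower 1≤v ⟩
  v                          ∎
  where
  open ≤-Reasoning
  exponents : K + suc (ord u) ≡ ord u + suc K
  exponents = trans (+-comm K (suc (ord u))) (sym (+-suc (ord u) K))

mod⇒% : ∀ m .{{_ : NonZero m}} {x y} → x mod m ≡ y mod m → x % m ≡ y % m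
mod⇒% m {x} {y} residues =
  trans (sym (toℕ-fromℕ< (m%n<n x m))) (trans (cong toℕ residues) (toℕ-fromℕ< (m%n<n y m)))

sameRemainder : ∀ m .{{_ : NonZero m}} {x y} → x % m ≡ y % m → x ≤ y → x ≡ y ⊎ x + m ≤ y
sameRemainder m {x} {y} remainders x≤y with <-cmp (x / m) (y / m)
... | tri≈ _ quotients _ = inj₁ (begin-equality
  x                   ≡⟨ m≡m%n+[m/n]*n x m ⟩
  x % m + x / m * m   ≡⟨ cong₂ (λ r k → r + k * m) remainders quotients ⟩
  y % m + y / m * m   ≡⟨ sym (m≡m%n+[m/n]*n y m) ⟩
  y                   ∎)
  where open ≤-Reasoning
... | tri< quotients _ _ = inj₂ (begin
  x + m                   ≡⟨ cong (_+ m) (m≡m%n+[m/n]*n x m) ⟩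
  x % m + x / m * m + m   ≡⟨ +-assoc (x % m) (x / m * m) m ⟩
  x % m + (x / m * m + m) ≡⟨ cong₂ _+_ remainders (+-comm (x / m * m) m) ⟩
  y % m + suc (x / m) * m ≤⟨ +-monoʳ-≤ (y % m) (*-monoˡ-≤ m quotients) ⟩
  y % m + y / m * m       ≡⟨ sym (m≡m%n+[m/n]*n y m) ⟩
  y                       ∎)
  where open ≤-Reasoning
... | tri> _ _ quotients = ⊥-elim (<⇒≱ quotients (/-monoˡ-≤ m x≤y))

sameResidue : ∀ m .{{_ : NonZero m}} {x y} → x mod m ≡ y mod m → x ≤ y → x ≡ y ⊎ x + m ≤ y
sameResidue m residues = sameRemainder m (mod⇒% m residues)

successorResidue : ∀ m .{{_ : NonZero m}} {a} → 1 < m → a mod m ≡ suc a mod m → ⊥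
successorResidue m {a} 1<m residues with sameResidue m residues (n≤1+n a)
... | inj₁ a≡1+a = 1+n≢n (sym a≡1+a)
... | inj₂ far = <⇒≱ (subst (_< a + m) (+-comm a 1) (+-monoʳ-< a 1<m)) far

comparable⇒sameOrder : ∀ K {u v} → 1 ≤ v → v ≤ K * u →
  ord u mod suc K ≡ ord v mod suc K → ord u ≤ ord v → ord u ≡ ord v
comparable⇒sameOrder K 1≤v v≤Ku residues ord-u≤ord-v with sameResidue (suc K) residues ord-u≤ord-v
... | inj₁ same = same
... | inj₂ far = ⊥-elim (<⇒≱ (ord-dominates K far 1≤v) v≤Ku)

flag : ∀ {P : Set} → Dec P → Fin 2
flag (yes _) = 1F
flag (no _) = 0F

flag-⇔ : ∀ {P Q : Set} (p? : Dec P) (q? : Dec Q) → flag p? ≡ flag q? → P ⇔ Q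
flag-⇔ (yes p) (yes q) _ = mk⇔ (λ _ → q) (λ _ → p)
flag-⇔ (no ¬p) (no ¬q) _ = mk⇔ (⊥-elim ∘ ¬p) (⊥-elim ∘ ¬q)
flag-⇔ (yes _) (no _) ()
flag-⇔ (no _) (yes _) ()

balance : ∀ x y → x Int.+ y ≡ + 0 → ∣ x ∣ ≡ ∣ y ∣
balance x y sum≡0 = trans (cong ∣_∣ x≡-y) (IntP.∣-i∣≡∣i∣ y)
  where
  x≡-y : x ≡ Int.- y
  x≡-y = IntP.i-j≡0⇒i≡j x (Int.- y) (trans (cong (Int._+_ x) (IntP.neg-involutive y)) sum≡0)

nonzero-abs : ∀ {a} → a ≢ + 0 → 1 ≤ ∣ a ∣
nonzero-abs a≢0 = n≢0⇒n>0 (a≢0 ∘ IntP.∣i∣≡0⇒i≡0)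

regroup-at-p : ∀ α β γ p d₁ d₂ →
  α Int.* p Int.+ β Int.* (p Int.+ d₁) Int.+ γ Int.* (p Int.+ d₁ Int.+ d₂)
    ≡ (α Int.+ β Int.+ γ) Int.* p Int.+ (β Int.* d₁ Int.+ γ Int.* (d₁ Int.+ d₂))
regroup-at-p = IntSolver.solve-∀

regroup-at-q : ∀ α β γ p d₁ d₂ →
  α Int.* p Int.+ β Int.* (p Int.+ d₁) Int.+ γ Int.* (p Int.+ d₁ Int.+ d₂)
    ≡ (α Int.+ β Int.+ γ) Int.* (p Int.+ d₁) Int.+ (Int.- α Int.* d₁ Int.+ γ Int.* d₂)
regroup-at-q = IntSolver.solve-∀

module ℕ-Comm = CommSemigroupProperties +-commutativeSemigroup
module ℤ-Comm = CommSemigroupProperties IntP.+-commutativeSemigroup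

module Colouring (K : ℕ) where

  m : ℕ
  m = suc K

  Hue : Set
  Hue = Fin m × Fin m × Fin 2 × Fin 2

  hue : ℕ → ℕ → Hue
  hue u v = ord v mod m , ord (v ∸ u) mod m ,
            flag (ord u ≟ ord v) , flag (ord (v ∸ u) + m ≤? ord v)

  colours : ℕ
  colours = m * (m * (2 * 2))

  encode : Hue → Fin colours
  encode (i , j , k , l) = combine i (combine j (combine k l))

  encode-injective : ∀ {h h'} → encode h ≡ encode h' → h ≡ h'
  encode-injective {i , j , k , l} {i' , j' , k' , l'} same
    with refl , same₁ ← combine-injective i _ i' _ same
    with refl , same₂ ← combine-injective j _ j' _ same₁
    with refl , refl ← combine-injective k l k' l' same₂ = refl

  colour : ℕ → ℕ → Fin colours
  colour u v = encode (hue (u ⊓ v) (u ⊔ v))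

  colour-sym : ∀ u v → colour u v ≡ colour v u
  colour-sym u v = cong₂ (λ a b → encode (hue a b)) (⊓-comm u v) (⊔-comm u v)

  colour-< : ∀ {u v} → u < v → colour u v ≡ encode (hue u v)
  colour-< u<v rewrite m≤n⇒m⊓n≡m (<⇒≤ u<v) | m≤n⇒m⊔n≡n (<⇒≤ u<v) = refl

  record Agree (u d v u' d' v' : ℕ) : Set where
    field
      topResidue : ord v mod m ≡ ord v' mod m
      gapResidue : ord d mod m ≡ ord d' mod m
      sameOrder  : (ord u ≡ ord v) ⇔ (ord u' ≡ ord v')
      farGap     : (ord d + m ≤ ord v) ⇔ (ord d' + m ≤ ord v')

  agree : ∀ {u d v u' d' v'} → v ∸ u ≡ d → v' ∸ u' ≡ d' → u < v → u' < v' →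
    colour u v ≡ colour u' v' → Agree u d v u' d' v'
  agree {u} {_} {v} {u'} {_} {v'} refl refl u<v u'<v' sameColour = record
    { topResidue = cong proj₁ hues
    ; gapResidue = cong (proj₁ ∘ proj₂) hues
    ; sameOrder  = flag-⇔ (ord u ≟ ord v) (ord u' ≟ ord v') (cong (proj₁ ∘ proj₂ ∘ proj₂) hues)
    ; farGap     = flag-⇔ (ord (v ∸ u) + m ≤? ord v) (ord (v' ∸ u') + m ≤? ord v')
                          (cong (proj₂ ∘ proj₂ ∘ proj₂) hues)
    }
    where
    hues : hue u v ≡ hue u' v'
    hues = encode-injective (trans (sym (colour-< u<v)) (trans sameColour (colour-< u'<v')))

  module SortedTriangle {α β γ : ℤ} {p d₁ d₂ : ℕ}
    (α≢0 : α ≢ + 0) (γ≢0 : γ ≢ + 0) (weight : ∣ α ∣ + ∣ β ∣ + ∣ γ ∣ ≤ K)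
    (1≤p : 1 ≤ p) (1≤d₁ : 1 ≤ d₁) (1≤d₂ : 1 ≤ d₂)
    (pq~ps : Agree p d₁ (p + d₁) p (d₁ + d₂) (p + d₁ + d₂))
    (qs~ps : Agree (p + d₁) d₂ (p + d₁ + d₂) p (d₁ + d₂) (p + d₁ + d₂))
    (solves : α Int.* + p Int.+ β Int.* + (p + d₁) Int.+ γ Int.* + (p + d₁ + d₂) ≡ + 0)
    where

    module PQ = Agree pq~ps
    module QS = Agree qs~ps
    open Equivalence using (to)

    q s d₃ A B G : ℕ
    q = p + d₁
    s = q + d₂
    d₃ = d₁ + d₂
    A = ∣ α ∣
    B = ∣ β ∣
    G = ∣ γ ∣

    1≤A : 1 ≤ A
    1≤A = nonzero-abs α≢0
    1≤G : 1 ≤ G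
    1≤G = nonzero-abs γ≢0
    A+B≤K : A + B ≤ K
    A+B≤K = ≤-trans (m≤m+n (A + B) G) weight
    B+G≤K : B + G ≤ K
    B+G≤K = ≤-trans (≤-trans (m≤n+m (B + G) A) (≤-reflexive (sym (+-assoc A B G)))) weight
    A≤K : A ≤ K
    A≤K = ≤-trans (m≤m+n A B) A+B≤K
    G≤K : G ≤ K
    G≤K = ≤-trans (m≤n+m G B) B+G≤K
    1<m : 1 < m
    1<m = s≤s (≤-trans 1≤A A≤K)

    1≤q : 1 ≤ q
    1≤q = ≤-trans 1≤p (m≤m+n p d₁)
    1≤s : 1 ≤ s
    1≤s = ≤-trans 1≤q (m≤m+n q d₂)
    1≤d₃ : 1 ≤ d₃
    1≤d₃ = ≤-trans 1≤d₁ (m≤m+n d₁ d₂)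

    -- From γ·s = −(α·p + β·q): the largest point is at most K times the middle one.
    s≤Kq : s ≤ K * q
    s≤Kq = begin
      s                             ≤⟨ m≤n*m s G {{>-nonZero 1≤G}} ⟩
      G * s                         ≡⟨ sym (IntP.∣i*j∣≡∣i∣*∣j∣ γ (+ s)) ⟩
      ∣ γ Int.* + s ∣               ≡⟨ sym (balance (α Int.* + p Int.+ β Int.* + q) (γ Int.* + s) solves) ⟩
      ∣ α Int.* + p Int.+ β Int.* + q ∣ ≤⟨ IntP.∣i+j∣≤∣i∣+∣j∣ (α Int.* + p) (β Int.* + q) ⟩
      ∣ α Int.* + p ∣ + ∣ β Int.* + q ∣ ≡⟨ cong₂ _+_ (IntP.∣i*j∣≡∣i∣*∣j∣ α (+ p)) (IntP.∣i*j∣≡∣i∣*∣j∣ β (+ q)) ⟩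
      A * p + B * q                 ≤⟨ +-monoˡ-≤ (B * q) (*-monoʳ-≤ A (m≤m+n p d₁)) ⟩
      A * q + B * q                 ≡⟨ sym (*-distribʳ-+ q A B) ⟩
      (A + B) * q                   ≤⟨ *-monoˡ-≤ q A+B≤K ⟩
      K * q                         ∎
      where open ≤-Reasoning

    ord-q≡ord-s : ord q ≡ ord s
    ord-q≡ord-s = comparable⇒sameOrder K 1≤s s≤Kq PQ.topResidue (ord-mono 1≤q (m≤m+n q d₂))

    ord-p≡ord-s : ord p ≡ ord s
    ord-p≡ord-s = to QS.sameOrder ord-q≡ord-s

    -- Three points in one dyadic interval span a gap of smaller order.
    ord-d₃<ord-s : ord d₃ < ord s
    ord-d₃<ord-s = ord-below 1≤d₃ (+-cancelˡ-< p d₃ (2 ^ ord s) p+d₃<p+2^t)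
      where
      open ≤-Reasoning
      p+d₃<p+2^t : p + d₃ < p + 2 ^ ord s
      p+d₃<p+2^t = begin-strict
        p + d₃                  ≡⟨ sym (+-assoc p d₁ d₂) ⟩
        s                       <⟨ ord-upper s ⟩
        2 ^ suc (ord s)         ≡⟨ 2^suc (ord s) ⟩
        2 ^ ord s + 2 ^ ord s   ≤⟨ +-monoˡ-≤ (2 ^ ord s) (subst (λ k → 2 ^ k ≤ p) ord-p≡ord-s (ord-lower 1≤p)) ⟩
        p + 2 ^ ord s           ∎

    -- The two short gaps cannot have the same order: their sum d₃ would have
    -- the next order, while ord d₁ ≡ ord d₃ mod m.
    gapsDiffer : ord d₁ ≢ ord d₂
    gapsDiffer same = successorResidue m 1<m
      (trans PQ.gapResidue (cong (_mod m) (ord-sum same 1≤d₁ 1≤d₂)))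

    -- Near case: no gap lies m orders below s, so every gap has the order of d₃.
    nearGaps : ¬ (ord d₃ + m ≤ ord s) → ⊥
    nearGaps near = gapsDiffer (trans (inherits {d₁} PQ.gapResidue ord-d₁≤ord-d₃ transfer₁)
                                      (sym (inherits {d₂} QS.gapResidue ord-d₂≤ord-d₃ (to QS.farGap))))
      where
      ord-d₁≤ord-d₃ : ord d₁ ≤ ord d₃
      ord-d₁≤ord-d₃ = ord-mono 1≤d₁ (m≤m+n d₁ d₂)
      ord-d₂≤ord-d₃ : ord d₂ ≤ ord d₃
      ord-d₂≤ord-d₃ = ord-mono 1≤d₂ (m≤n+m d₂ d₁)
      transfer₁ : ord d₁ + m ≤ ord s → ord d₃ + m ≤ ord s
      transfer₁ = to PQ.farGap ∘ subst (ord d₁ + m ≤_) (sym ord-q≡ord-s)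
      inherits : ∀ {d} → ord d mod m ≡ ord d₃ mod m → ord d ≤ ord d₃ →
        (ord d + m ≤ ord s → ord d₃ + m ≤ ord s) → ord d ≡ ord d₃
      inherits residues ord-d≤ord-d₃ transfer with sameResidue m residues ord-d≤ord-d₃
      ... | inj₁ same = same
      ... | inj₂ far = ⊥-elim (near (transfer (≤-trans far (<⇒≤ ord-d₃<ord-s))))

    -- Far case: d₃ lies m orders below p, so K·d₃ < p.
    module FarGaps (far : ord d₃ + m ≤ ord s) where

      Kd₃<p : K * d₃ < p
      Kd₃<p = ord-dominates K (subst (ord d₃ + m ≤_) (sym ord-p≡ord-s) far) 1≤p

      S : ℤ
      S = α Int.+ β Int.+ γ

      nonzeroSum : S ≢ + 0 → ⊥
      nonzeroSum S≢0 = <-irrefl refl (begin-strict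
        p                   ≤⟨ m≤n*m p ∣ S ∣ {{>-nonZero (nonzero-abs S≢0)}} ⟩
        ∣ S ∣ * p            ≡⟨ sym (IntP.∣i*j∣≡∣i∣*∣j∣ S (+ p)) ⟩
        ∣ S Int.* + p ∣      ≡⟨ balance (S Int.* + p) (β Int.* + d₁ Int.+ γ Int.* + d₃)
                                  (trans (sym (regroup-at-p α β γ (+ p) (+ d₁) (+ d₂))) solves) ⟩
        ∣ β Int.* + d₁ Int.+ γ Int.* + d₃ ∣ ≤⟨ IntP.∣i+j∣≤∣i∣+∣j∣ (β Int.* + d₁) (γ Int.* + d₃) ⟩
        ∣ β Int.* + d₁ ∣ + ∣ γ Int.* + d₃ ∣ ≡⟨ cong₂ _+_ (IntP.∣i*j∣≡∣i∣*∣j∣ β (+ d₁)) (IntP.∣i*j∣≡∣i∣*∣j∣ γ (+ d₃)) ⟩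
        B * d₁ + G * d₃     ≤⟨ +-monoˡ-≤ (G * d₃) (*-monoʳ-≤ B (m≤m+n d₁ d₂)) ⟩
        B * d₃ + G * d₃     ≡⟨ sym (*-distribʳ-+ d₃ B G) ⟩
        (B + G) * d₃        ≤⟨ *-monoˡ-≤ d₃ B+G≤K ⟩
        K * d₃              <⟨ Kd₃<p ⟩
        p                   ∎)
        where open ≤-Reasoning

      -- If a + b + c = 0 the equation reads −a·d₁ + c·d₂ = 0, so |a|·d₁ = |c|·d₂;
      -- the short gaps are then within a factor K and share their order.
      zeroSum : S ≡ + 0 → ⊥
      zeroSum S≡0 = gapsDiffer ord-d₁≡ord-d₂
        where
        X : ℤ
        X = Int.- α Int.* + d₁ Int.+ γ Int.* + d₂
        gapEquation : X ≡ + 0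
        gapEquation = begin
          X                                                ≡⟨ sym (IntP.+-identityˡ X) ⟩
          + 0 Int.+ X                                      ≡⟨ cong (Int._+ X) (sym (IntP.*-zeroˡ (+ q))) ⟩
          + 0 Int.* + q Int.+ X                            ≡⟨ cong (λ t → t Int.* + q Int.+ X) (sym S≡0) ⟩
          S Int.* + q Int.+ X                              ≡⟨ sym (regroup-at-q α β γ (+ p) (+ d₁) (+ d₂)) ⟩
          α Int.* + p Int.+ β Int.* + q Int.+ γ Int.* + s  ≡⟨ solves ⟩
          + 0                                              ∎
          where open ≡-Reasoning
        Ad₁≡Gd₂ : A * d₁ ≡ G * d₂
        Ad₁≡Gd₂ = begin
          A * d₁                   ≡⟨ cong (_* d₁) (sym (IntP.∣-i∣≡∣i∣ α)) ⟩
          ∣ Int.- α ∣ * d₁          ≡⟨ sym (IntP.∣i*j∣≡∣i∣*∣j∣ (Int.- α) (+ d₁)) ⟩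
          ∣ Int.- α Int.* + d₁ ∣    ≡⟨ balance (Int.- α Int.* + d₁) (γ Int.* + d₂) gapEquation ⟩
          ∣ γ Int.* + d₂ ∣          ≡⟨ IntP.∣i*j∣≡∣i∣*∣j∣ γ (+ d₂) ⟩
          G * d₂                   ∎
          where open ≡-Reasoning
        d₂≤Kd₁ : d₂ ≤ K * d₁
        d₂≤Kd₁ = ≤-trans (m≤n*m d₂ G {{>-nonZero 1≤G}})
                   (≤-trans (≤-reflexive (sym Ad₁≡Gd₂)) (*-monoˡ-≤ d₁ A≤K))
        d₁≤Kd₂ : d₁ ≤ K * d₂
        d₁≤Kd₂ = ≤-trans (m≤n*m d₁ A {{>-nonZero 1≤A}})
                   (≤-trans (≤-reflexive Ad₁≡Gd₂) (*-monoˡ-≤ d₂ G≤K))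
        residues : ord d₁ mod m ≡ ord d₂ mod m
        residues = trans PQ.gapResidue (sym QS.gapResidue)
        ord-d₁≡ord-d₂ : ord d₁ ≡ ord d₂
        ord-d₁≡ord-d₂ with ≤-total (ord d₁) (ord d₂)
        ... | inj₁ ≤ord-d₂ = comparable⇒sameOrder K 1≤d₂ d₂≤Kd₁ residues ≤ord-d₂
        ... | inj₂ ≤ord-d₁ = sym (comparable⇒sameOrder K 1≤d₁ d₁≤Kd₂ (sym residues) ≤ord-d₁)

      farGaps : ⊥
      farGaps with S Int.≟ + 0
      ... | yes S≡0 = zeroSum S≡0
      ... | no S≢0 = nonzeroSum S≢0

    impossible : ⊥
    impossible with ord d₃ + m ≤? ord s
    ... | yes far = FarGaps.farGaps far
    ... | no near = nearGaps near

  NoMonoSolution : ℕ → ℕ → ℕ → Set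
  NoMonoSolution x y z = ∀ {α β γ c} → α ≢ + 0 → β ≢ + 0 → γ ≢ + 0 →
    ∣ α ∣ + ∣ β ∣ + ∣ γ ∣ ≤ K →
    colour x y ≡ c → colour y z ≡ c → colour x z ≡ c →
    α Int.* + x Int.+ β Int.* + y Int.+ γ Int.* + z ≡ + 0 → ⊥

  gap : ∀ {x y} → x < y → ∃[ d ] 1 ≤ d × y ≡ x + d
  gap {x} {y} x<y = y ∸ x , m<n⇒0<n∸m x<y , sym (m+[n∸m]≡n (<⇒≤ x<y))

  sorted : ∀ {x y z} → 1 ≤ x → x < y → y < z → NoMonoSolution x y z
  sorted {x} 1≤x x<y y<z {β = β} α≢0 _ γ≢0 weight xy yz xz solves with gap x<y
  ... | d₁ , 1≤d₁ , refl with gap y<z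
  ... | d₂ , 1≤d₂ , refl =
    SortedTriangle.impossible {β = β} α≢0 γ≢0 weight 1≤x 1≤d₁ 1≤d₂
      (agree (m+n∸m≡n x d₁) outerGap x<y x<z (trans xy (sym xz)))
      (agree (m+n∸m≡n (x + d₁) d₂) outerGap y<z x<z (trans yz (sym xz)))
      solves
    where
    x<z : x < x + d₁ + d₂
    x<z = <-trans x<y y<z
    outerGap : x + d₁ + d₂ ∸ x ≡ d₁ + d₂
    outerGap = trans (cong (_∸ x) (+-assoc x d₁ d₂)) (m+n∸m≡n x (d₁ + d₂))

  swap₁₂ : ∀ {x y z} → NoMonoSolution y x z → NoMonoSolution x y z
  swap₁₂ {x} {y} {z} noSolution {α} {β} {γ} α≢0 β≢0 γ≢0 weight xy yz xz solves =
    noSolution β≢0 α≢0 γ≢0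
      (subst (_≤ K) (cong (_+ ∣ γ ∣) (+-comm (∣ α ∣) (∣ β ∣))) weight)
      (trans (colour-sym y x) xy) xz yz
      (trans (cong (Int._+ γ Int.* + z) (IntP.+-comm (β Int.* + y) (α Int.* + x))) solves)

  swap₂₃ : ∀ {x y z} → NoMonoSolution x z y → NoMonoSolution x y z
  swap₂₃ {x} {y} {z} noSolution {α} {β} {γ} α≢0 β≢0 γ≢0 weight xy yz xz solves =
    noSolution α≢0 γ≢0 β≢0
      (subst (_≤ K) (ℕ-Comm.xy∙z≈xz∙y (∣ α ∣) (∣ β ∣) (∣ γ ∣)) weight)
      xz (trans (colour-sym z y) yz) xy
      (trans (ℤ-Comm.xy∙z≈xz∙y (α Int.* + x) (γ Int.* + z) (β Int.* + y)) solves)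

  noMonoSolution-from : ∀ {x y z} → 1 ≤ x → 1 ≤ z → x < y → y ≢ z → x ≢ z → NoMonoSolution x y z
  noMonoSolution-from {x} {y} {z} 1≤x 1≤z x<y y≢z x≢z with <-cmp y z | <-cmp x z
  ... | tri< y<z _ _ | _ = sorted 1≤x x<y y<z
  ... | tri≈ _ y≡z _ | _ = ⊥-elim (y≢z y≡z)
  ... | tri> _ _ z<y | tri< x<z _ _ = swap₂₃ (sorted 1≤x x<z z<y)
  ... | tri> _ _ z<y | tri≈ _ x≡z _ = ⊥-elim (x≢z x≡z)
  ... | tri> _ _ z<y | tri> _ _ z<x = swap₂₃ (swap₁₂ (sorted 1≤z z<x x<y))

  noMonoSolution : ∀ {x y z} → 1 ≤ x → 1 ≤ y → 1 ≤ z → x ≢ y → y ≢ z → x ≢ z → NoMonoSolution x y z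
  noMonoSolution {x} {y} 1≤x 1≤y 1≤z x≢y y≢z x≢z with <-cmp x y
  ... | tri< x<y _ _ = noMonoSolution-from 1≤x 1≤z x<y y≢z x≢z
  ... | tri≈ _ x≡y _ = ⊥-elim (x≢y x≡y)
  ... | tri> _ _ y<x = swap₁₂ (noMonoSolution-from 1≤y 1≤z y<x x≢z y≢z)

sumFin-3 : ∀ f → sumFin 3 f ≡ f 0F Int.+ f 1F Int.+ f 2F
sumFin-3 f = trans (cong (Int._+_ (f 0F)) (cong (Int._+_ (f 1F)) (IntP.+-identityʳ (f 2F))))
                   (sym (IntP.+-assoc (f 0F) (f 1F) (f 2F)))

corollary3p3 : (a b c : ℤ) → a ≢ + 0 → b ≢ + 0 → c ≢ + 0 →
    ¬ GraphRegular 3 (a ∷ b ∷ c ∷ [])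
corollary3p3 a b c a≢0 b≢0 c≢0 (N₀ , regular) =
  noMonochromatic (regular colours N (n<1+n (N₀ colours)) edgeColouring)
  where
  open Colouring (∣ a ∣ + ∣ b ∣ + ∣ c ∣)
  N : ℕ
  N = suc (N₀ colours)
  edgeColouring : EdgeColouring colours N
  edgeColouring = colour , λ u v _ _ _ _ → colour-sym u v
  noMonochromatic : MonoSolution 3 (a ∷ b ∷ c ∷ []) colours N edgeColouring → ⊥
  noMonochromatic (x , injective , inRange , solves , _ , mono) =
    noMonoSolution (proj₁ (inRange 0F)) (proj₁ (inRange 1F)) (proj₁ (inRange 2F))
      (distinct 0F 1F (λ ())) (distinct 1F 2F (λ ())) (distinct 0F 2F (λ ()))
      a≢0 b≢0 c≢0 ≤-refl
      (mono 0F 1F (λ ())) (mono 1F 2F (λ ())) (mono 0F 2F (λ ()))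
      (trans (sym (sumFin-3 (λ i → (a ∷ b ∷ c ∷ []) i Int.* + x i))) solves)
    where
    distinct : ∀ i j → i ≢ j → x i ≢ x j
    distinct i j i≢j = i≢j ∘ injective
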